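{- Let $k\ge 4$, $n\ge 1$, and let $G$ be a $C_4$-saturated spanning subgraph of $K_k^n$. If $\delta(G)=1$, then $e(G) \geq \left\lfloor \frac{3(k-1)n -2}{2} \right\rfloor$.
   Context: All graphs are finite, simple and undirected. $K_k^n$ denotes the complete $k$-partite graph with exactly $n$ vertices in each of its $k$ parts. $C_4$ is the cycle on $4$ vertices. A spanning subgraph $H$ of $K_k^n$ is $C_4$-saturated (relative to $K_k^n$) if $H$ contains no $C_4$ but $H+e$ contains a $C_4$ for every $e\in E(K_k^n)\setminus E(H)$. $\delta(G)$ is the minimum degree and $e(G)$ the number of edges. -}

module Defs where

open import Data.Nat using (ℕ; _+_; _*_; _∸_; _/_)
open import Data.Fin using (Fin)
open import Data.Bool using (Bool; true; false; _∨_; _∧_; if_then_else_)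
open import Data.Product using (_×_; _,_; proj₁; Σ; ∃)
open import Data.Nat.ListAction using (sum)
open import Data.List using (List; map; allFin; cartesianProduct; filter; length)
open import Relation.Binary.PropositionalEquality using (_≡_; _≢_)
open import Relation.Nullary using (¬_)

-- Vertices of K_k^n: (part, index within part).
Vertex : ℕ → ℕ → Set
Vertex k n = Fin k × Fin n

Adj : ℕ → ℕ → Set
Adj k n = Vertex k n → Vertex k n → Bool

HostEdge : ∀ {k n} → Vertex k n → Vertex k n → Set
HostEdge u v = proj₁ u ≢ proj₁ v

record IsSpanningSubgraph {k n : ℕ} (H : Adj k n) : Set where
  field
    symmetric : ∀ u v → H u v ≡ H v u
    inHost    : ∀ u v → H u v ≡ true → HostEdge u v

ContainsC4 : ∀ {k n} → Adj k n → Set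
ContainsC4 {k} {n} H =
  Σ (Vertex k n) λ a → Σ (Vertex k n) λ b → Σ (Vertex k n) λ c → Σ (Vertex k n) λ d →
    (a ≢ b) × (a ≢ c) × (a ≢ d) × (b ≢ c) × (b ≢ d) × (c ≢ d) ×
    (H a b ≡ true) × (H b c ≡ true) × (H c d ≡ true) × (H d a ≡ true)

open import Data.Fin using (_≟_)
open import Relation.Nullary using (does)

eqV : ∀ {k n} → Vertex k n → Vertex k n → Bool
eqV (i , j) (i' , j') = does (i ≟ i') ∧ does (j ≟ j')

addEdge : ∀ {k n} → Adj k n → Vertex k n → Vertex k n → Adj k n
addEdge H u v x y = H x y ∨ ((eqV x u ∧ eqV y v) ∨ (eqV x v ∧ eqV y u))

record IsC4Saturated {k n : ℕ} (H : Adj k n) : Set where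
  field
    spanning : IsSpanningSubgraph H
    c4free   : ¬ ContainsC4 H
    saturated : ∀ u v → HostEdge u v → H u v ≡ false → ContainsC4 (addEdge H u v)

allVertices : (k n : ℕ) → List (Vertex k n)
allVertices k n = cartesianProduct (allFin k) (allFin n)

b2n : Bool → ℕ
b2n true = 1
b2n false = 0

degree : ∀ {k n} → Adj k n → Vertex k n → ℕ
degree {k} {n} H v = sum (map (λ u → b2n (H v u)) (allVertices k n))

-- Number of edges: half the degree sum (handshake; H is symmetric and loopless).
edgeCount : ∀ {k n} → Adj k n → ℕ
edgeCount {k} {n} H = sum (map (degree H) (allVertices k n)) / 2

MinDegree : ∀ {k n} → Adj k n → ℕ → Set
MinDegree {k} {n} H m = (∀ v → m Data.Nat.≤ degree H v) × ∃ λ v → degree H v ≡ m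

-- Let P be a part containing the most leaves, v ∈ P a leaf and w its neighbour. If u and y
-- lie in different parts and are not adjacent, the C4 of G + uy must use uy, so G has a walk
-- u ~ p ~ q ~ y with q ≠ u. For leaves (using a third part) this shows that leaves are never
-- adjacent, that neighbours of leaves in different parts are adjacent, and that every vertex
-- of X = V ∖ (P ∪ {w}) has a neighbour in N(w).
--
-- Let B = X ∖ N(w), and let E be the set of vertices outside N(w) that lie in P or are
-- non-leaves of X. Counting each edge from both ends, every vertex of X sends an edge into
-- N(w), every vertex of B receives one from N(w), and every vertex of E has a further edge,
-- so Σ deg ≥ 2 deg w + |X| + |E| + |B|. Weighting the vertices one by one gives
--   3(k-1)n + n + |P ∩ N(w)| ≤ 2 deg w + |X| + |E| + |B| + 3 + (leaves outside P).
-- If the leaves outside P meet two parts R and S, a C4 argument puts every leaf into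
-- P ∪ R ∪ S and makes every leaf of P adjacent to w, so by maximality of P there are at most
-- |P ∩ N(w)| + n of them; otherwise they lie in a single part. Hence Σ deg ≥ 3(k-1)n - 3,
-- and Σ deg is even.

module Submission where

open import Data.Bool using (Bool; true; false; not; _∧_; _∨_; T)
open import Data.Bool.Properties using (¬-not; not-¬)
open import Data.Empty using (⊥; ⊥-elim)
open import Data.Fin as Fin using (Fin; zero; suc)
open import Data.List using (List; []; _∷_; map; _++_; cartesianProduct; length; allFin)
open import Data.List.Extrema.Nat using (argmax; f[xs]≤f[argmax]; f[⊥]≤f[argmax])
open import Data.List.Membership.Propositional using (_∈_)
open import Data.List.Membership.Propositional.Properties using (∈-allFin; ∈-cartesianProduct⁺)
open import Data.List.Properties using (map-++; map-∘; length-tabulate)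
open import Data.List.Relation.Unary.All as All using (All; []; _∷_)
open import Data.List.Relation.Unary.AllPairs using (AllPairs; []; _∷_)
open import Data.List.Relation.Unary.Any using (here; there)
open import Data.List.Relation.Unary.Unique.Propositional using (Unique)
open import Data.List.Relation.Unary.Unique.Propositional.Properties using (allFin⁺; cartesianProduct⁺)
open import Data.Nat using (ℕ; _+_; _*_; _∸_; _/_; _≤_; _≡ᵇ_; z≤n; s≤s; _≤?_)
open import Data.Nat.Divisibility using (_∣_; divides; ∣m∣n⇒∣m+n; m∣m*n)
open import Data.Nat.DivMod using (m*n/n≡m; m<n*o⇒m/o<n)
open import Data.Nat.ListAction using (sum)
open import Data.Nat.ListAction.Properties using (sum-++)
open import Data.Nat.Properties
open import Algebra.Properties.CommutativeSemigroup +-commutativeSemigroup using (interchange)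
open import Data.Product using (∃; _×_; _,_; proj₁; proj₂; uncurry)
open import Data.Product.Properties using (,-injective)
open import Data.Sum using (_⊎_; inj₁; inj₂)
open import Data.Unit using (tt)
open import Function using (_∘_; id)
open import Relation.Binary.Definitions using (DecidableEquality)
open import Relation.Binary.PropositionalEquality
open import Relation.Nullary using (¬_; Dec; yes; no; does)
open import Relation.Nullary.Decidable using (map′; _×-dec_; dec-true; dec-false)

open import Defs

private variable
  A A′ : Set

∧-true : ∀ {a b} → a ∧ b ≡ true → a ≡ true × b ≡ true
∧-true {true} {true} _ = refl , refl

∨-true : ∀ {a b} → a ∨ b ≡ true → a ≡ true ⊎ b ≡ true
∨-true {true}         _ = inj₁ refl
∨-true {false} {true} _ = inj₂ refl

does-true : ∀ {P : Set} (P? : Dec P) → does P? ≡ true → P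
does-true (yes p) _ = p

not-true : ∀ {a} → not a ≡ true → a ≡ false
not-true {false} _ = refl

does-false : ∀ {P : Set} (P? : Dec P) → does P? ≡ false → ¬ P
does-false (no ¬p) _ = ¬p

b2n-∧-≤ˡ : ∀ a b → b2n (a ∧ b) ≤ b2n a
b2n-∧-≤ˡ true  true  = ≤-refl
b2n-∧-≤ˡ true  false = z≤n
b2n-∧-≤ˡ false _     = z≤n

b2n-∧ : ∀ a b → b2n (a ∧ b) ≡ b2n a * b2n b
b2n-∧ true  b = sym (+-identityʳ (b2n b))
b2n-∧ false b = refl

-- degree and edgeCount from Defs are definitionally sums of this form over allVertices.
∑ : List A → (A → ℕ) → ℕ
∑ xs f = sum (map f xs)

∑-cong : ∀ (xs : List A) {f g : A → ℕ} → (∀ x → f x ≡ g x) → ∑ xs f ≡ ∑ xs g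
∑-cong []       f≗g = refl
∑-cong (x ∷ xs) f≗g = cong₂ _+_ (f≗g x) (∑-cong xs f≗g)

∑-mono-≤ : ∀ (xs : List A) {f g : A → ℕ} → (∀ x → f x ≤ g x) → ∑ xs f ≤ ∑ xs g
∑-mono-≤ []       f≤g = z≤n
∑-mono-≤ (x ∷ xs) f≤g = +-mono-≤ (f≤g x) (∑-mono-≤ xs f≤g)

∑-+ : ∀ (xs : List A) (f g : A → ℕ) → ∑ xs (λ x → f x + g x) ≡ ∑ xs f + ∑ xs g
∑-+ []       f g = refl
∑-+ (x ∷ xs) f g =
  trans (cong (f x + g x +_) (∑-+ xs f g)) (interchange (f x) (g x) (∑ xs f) (∑ xs g))

∑-*ˡ : ∀ (xs : List A) c (f : A → ℕ) → ∑ xs (λ x → c * f x) ≡ c * ∑ xs f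
∑-*ˡ []       c f = sym (*-zeroʳ c)
∑-*ˡ (x ∷ xs) c f =
  trans (cong (c * f x +_) (∑-*ˡ xs c f)) (sym (*-distribˡ-+ c (f x) (∑ xs f)))

∑-const : ∀ (xs : List A) c → ∑ xs (λ _ → c) ≡ length xs * c
∑-const []       c = refl
∑-const (x ∷ xs) c = cong (c +_) (∑-const xs c)

∑-comm : ∀ (xs : List A) (ys : List A′) (h : A → A′ → ℕ) →
         ∑ xs (λ x → ∑ ys (h x)) ≡ ∑ ys (λ y → ∑ xs (λ x → h x y))
∑-comm []       ys h = sym (trans (∑-const ys 0) (*-zeroʳ (length ys)))
∑-comm (x ∷ xs) ys h =
  trans (cong (∑ ys (h x) +_) (∑-comm xs ys h)) (sym (∑-+ ys (h x) _))

∑-++ : ∀ (xs ys : List A) (f : A → ℕ) → ∑ (xs ++ ys) f ≡ ∑ xs f + ∑ ys f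
∑-++ xs ys f = trans (cong sum (map-++ f xs ys)) (sum-++ (map f xs) (map f ys))

∑-map : ∀ (xs : List A) (g : A → A′) (f : A′ → ℕ) → ∑ (map g xs) f ≡ ∑ xs (f ∘ g)
∑-map xs g f = cong sum (sym (map-∘ xs))

∑-cartesianProduct : ∀ (xs : List A) (ys : List A′) f →
                     ∑ (cartesianProduct xs ys) f ≡ ∑ xs (λ x → ∑ ys (λ y → f (x , y)))
∑-cartesianProduct []       ys f = refl
∑-cartesianProduct (x ∷ xs) ys f =
  trans (∑-++ (map (x ,_) ys) (cartesianProduct xs ys) f)
        (cong₂ _+_ (∑-map ys (x ,_) f) (∑-cartesianProduct xs ys f))

∈⇒≤∑ : ∀ {xs : List A} {y} (f : A → ℕ) → y ∈ xs → f y ≤ ∑ xs f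
∈⇒≤∑ f (here refl)             = m≤m+n _ _
∈⇒≤∑ {xs = x ∷ _} f (there y∈) = ≤-trans (∈⇒≤∑ f y∈) (m≤n+m _ (f x))

1≤∑b2n⇒∃ : ∀ (xs : List A) (p : A → Bool) → 1 ≤ ∑ xs (λ x → b2n (p x)) → ∃ λ x → p x ≡ true
1≤∑b2n⇒∃ (x ∷ xs) p 1≤∑ with p x in px
... | true  = x , px
... | false = 1≤∑b2n⇒∃ xs p 1≤∑

∑b2n-complement : ∀ (xs : List A) (p : A → Bool) →
                  ∑ xs (λ x → b2n (not (p x))) + ∑ xs (λ x → b2n (p x)) ≡ length xs
∑b2n-complement xs p = begin
  ∑ xs (λ x → b2n (not (p x))) + ∑ xs (λ x → b2n (p x)) ≡⟨ ∑-+ xs _ _ ⟨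
  ∑ xs (λ x → b2n (not (p x)) + b2n (p x))               ≡⟨ ∑-cong xs (λ x → b2n-not (p x)) ⟩
  ∑ xs (λ _ → 1)                                          ≡⟨ ∑-const xs 1 ⟩
  length xs * 1                                           ≡⟨ *-identityʳ _ ⟩
  length xs                                               ∎
  where
  open ≡-Reasoning
  b2n-not : ∀ b → b2n (not b) + b2n b ≡ 1
  b2n-not true  = refl
  b2n-not false = refl

module _ (_≟_ : DecidableEquality A) where

  ∑-select-∉ : ∀ {xs y} (f : A → ℕ) → All (y ≢_) xs →
               ∑ xs (λ x → b2n (does (x ≟ y)) * f x) ≡ 0
  ∑-select-∉ f [] = refl
  ∑-select-∉ {x ∷ _} {y} f (y≢x ∷ y∉xs)
    rewrite dec-false (x ≟ y) (y≢x ∘ sym) = ∑-select-∉ f y∉xs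

  ∑-select : ∀ {xs y} (f : A → ℕ) → Unique xs → y ∈ xs →
             ∑ xs (λ x → b2n (does (x ≟ y)) * f x) ≡ f y
  ∑-select {y = y} f (y∉xs ∷ _) (here refl)
    rewrite dec-true (y ≟ y) refl | ∑-select-∉ f y∉xs = trans (+-identityʳ _) (+-identityʳ (f y))
  ∑-select {x ∷ _} {y} f (x∉xs ∷ xs!) (there y∈xs)
    rewrite dec-false (x ≟ y) (All.lookup x∉xs y∈xs) = ∑-select f xs! y∈xs

  ∑-indicator : ∀ {xs y} → Unique xs → y ∈ xs → ∑ xs (λ x → b2n (does (x ≟ y))) ≡ 1
  ∑-indicator {xs} {y} xs! y∈xs =
    trans (sym (∑-cong xs (λ x → *-identityʳ (b2n (does (x ≟ y)))))) (∑-select (λ _ → 1) xs! y∈xs)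

∑∑-even : ∀ (xs : List A) (h : A → A → ℕ) → (∀ x y → h x y ≡ h y x) → (∀ x → h x x ≡ 0) →
          2 ∣ ∑ xs (λ x → ∑ xs (h x))
∑∑-even []       h sym-h h-diag = divides 0 refl
∑∑-even (y ∷ xs) h sym-h h-diag =
  subst (2 ∣_) (sym split-off-y) (∣m∣n⇒∣m+n (m∣m*n r) (∑∑-even xs h sym-h h-diag))
  where
  open ≡-Reasoning
  r    = ∑ xs (h y)
  rest = ∑ xs (λ x → ∑ xs (h x))
  split-off-y : h y y + r + ∑ xs (λ x → h x y + ∑ xs (h x)) ≡ 2 * r + rest
  split-off-y = begin
    h y y + r + ∑ xs (λ x → h x y + ∑ xs (h x))
      ≡⟨ cong₂ (λ d s → d + r + s) (h-diag y) (∑-+ xs (λ x → h x y) _) ⟩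
    r + (∑ xs (λ x → h x y) + rest)
      ≡⟨ cong (λ s → r + (s + rest)) (∑-cong xs (λ x → sym-h x y)) ⟩
    r + (r + rest)
      ≡⟨ +-assoc r r rest ⟨
    r + r + rest
      ≡⟨ cong (λ s → r + s + rest) (+-identityʳ r) ⟨
    2 * r + rest ∎

∈⇒1≤∑b2n : ∀ {xs : List A} {y} (p : A → Bool) → y ∈ xs → p y ≡ true → 1 ≤ ∑ xs (λ x → b2n (p x))
∈⇒1≤∑b2n p y∈xs py = ≤-trans (≤-reflexive (cong b2n (sym py))) (∈⇒≤∑ (λ x → b2n (p x)) y∈xs)

sum-b2n-false : ∀ {bs : List Bool} → All (λ b → b ≡ true → ⊥) bs → sum (map b2n bs) ≡ 0
sum-b2n-false {[]}         []        = refl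
sum-b2n-false {true ∷ _}   (¬t ∷ _)  = ⊥-elim (¬t refl)
sum-b2n-false {false ∷ _}  (_ ∷ ¬ts) = sum-b2n-false ¬ts

sum-b2n-disjoint : ∀ {g} {bs : List Bool} → All (λ b → b ≡ true → g ≡ true) bs →
                   AllPairs (λ a b → a ≡ true → b ≡ true → ⊥) bs → sum (map b2n bs) ≤ b2n g
sum-b2n-disjoint {bs = []}          []          []           = z≤n
sum-b2n-disjoint {bs = false ∷ _}   (_ ∷ ⇒g)    (_ ∷ disj)   = sum-b2n-disjoint ⇒g disj
sum-b2n-disjoint {bs = true  ∷ bs}  (b⇒g ∷ _)   (b#bs ∷ _)
  rewrite b⇒g refl | sum-b2n-false (All.map (λ b# → b# refl) b#bs) = ≤-refl

half-∸2-≤ : ∀ {t d} → 2 ∣ d → t ≤ d + 3 → (t ∸ 2) / 2 ≤ d / 2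
half-∸2-≤ {t} (divides q refl) t≤d+3 =
  subst ((t ∸ 2) / 2 ≤_) (sym (m*n/n≡m q 2))
    (≤-pred (m<n*o⇒m/o<n (s≤s (∸-monoˡ-≤ 2 (subst (t ≤_) (+-comm (q * 2) 3) t≤d+3)))))

length-allFin : ∀ m → length (allFin m) ≡ m
length-allFin m = length-tabulate {A = Fin m} id

module _ {k n : ℕ} where

  -- Built so that does (x ≟V y) is definitionally eqV x y, the test used by addEdge.
  _≟V_ : DecidableEquality (Vertex k n)
  (i , j) ≟V (i′ , j′) = map′ (uncurry (cong₂ _,_)) ,-injective ((i Fin.≟ i′) ×-dec (j Fin.≟ j′))

  allVertices-unique : Unique (allVertices k n)
  allVertices-unique = cartesianProduct⁺ (allFin⁺ k) (allFin⁺ n)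

  ∈-allVertices : ∀ (u : Vertex k n) → u ∈ allVertices k n
  ∈-allVertices (i , j) = ∈-cartesianProduct⁺ (∈-allFin i) (∈-allFin j)

  ∑V : (Vertex k n → ℕ) → ℕ
  ∑V = ∑ (allVertices k n)

  ∣_∣ : (Vertex k n → Bool) → ℕ
  ∣ p ∣ = ∑V (λ u → b2n (p u))

  ∑V-select : ∀ (f : Vertex k n → ℕ) y → ∑V (λ x → b2n (does (x ≟V y)) * f x) ≡ f y
  ∑V-select f y = ∑-select _≟V_ f allVertices-unique (∈-allVertices y)

  ∣≟V∣ : ∀ y → ∣ (λ x → does (x ≟V y)) ∣ ≡ 1
  ∣≟V∣ y = ∑-indicator _≟V_ allVertices-unique (∈-allVertices y)

  inPart : Fin k → Vertex k n → Bool
  inPart i u = does (proj₁ u Fin.≟ i)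

  ∑V-byPart : ∀ (f : Fin k → ℕ) → ∑V (λ u → f (proj₁ u)) ≡ n * ∑ (allFin k) f
  ∑V-byPart f = begin
    ∑V (λ u → f (proj₁ u))                         ≡⟨ ∑-cartesianProduct (allFin k) (allFin n) _ ⟩
    ∑ (allFin k) (λ i → ∑ (allFin n) (λ _ → f i))  ≡⟨ ∑-cong (allFin k) (λ i → ∑-const (allFin n) (f i)) ⟩
    ∑ (allFin k) (λ i → length (allFin n) * f i)   ≡⟨ ∑-*ˡ (allFin k) (length (allFin n)) f ⟩
    length (allFin n) * ∑ (allFin k) f             ≡⟨ cong (_* ∑ (allFin k) f) (length-allFin n) ⟩
    n * ∑ (allFin k) f                             ∎
    where open ≡-Reasoning

  ∣inPart∣ : ∀ i → ∣ inPart i ∣ ≡ n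
  ∣inPart∣ i = begin
    ∣ inPart i ∣
      ≡⟨ ∑V-byPart (λ j → b2n (does (j Fin.≟ i))) ⟩
    n * ∑ (allFin k) (λ j → b2n (does (j Fin.≟ i)))
      ≡⟨ cong (n *_) (∑-indicator Fin._≟_ (allFin⁺ k) (∈-allFin i)) ⟩
    n * 1
      ≡⟨ *-identityʳ n ⟩
    n ∎
    where open ≡-Reasoning

  ∣outsidePart∣ : ∀ i → ∣ (λ u → not (inPart i u)) ∣ ≡ (k ∸ 1) * n
  ∣outsidePart∣ i = begin
    ∣ (λ u → not (inPart i u)) ∣ ≡⟨ ∑V-byPart (λ j → b2n (not (does (j Fin.≟ i)))) ⟩
    n * others                   ≡⟨ cong (n *_) others≡k∸1 ⟩
    n * (k ∸ 1)                  ≡⟨ *-comm n (k ∸ 1) ⟩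
    (k ∸ 1) * n                  ∎
    where
    open ≡-Reasoning
    others = ∑ (allFin k) (λ j → b2n (not (does (j Fin.≟ i))))
    others≡k∸1 : others ≡ k ∸ 1
    others≡k∸1 = begin
      others                                                    ≡⟨ m+n∸n≡m others 1 ⟨
      others + 1 ∸ 1
        ≡⟨ cong (λ m → others + m ∸ 1) (∑-indicator Fin._≟_ (allFin⁺ k) (∈-allFin i)) ⟨
      others + ∑ (allFin k) (λ j → b2n (does (j Fin.≟ i))) ∸ 1
        ≡⟨ cong (_∸ 1) (trans (∑b2n-complement (allFin k) (λ j → does (j Fin.≟ i))) (length-allFin k)) ⟩
      k ∸ 1 ∎

avoid-two : ∀ {m} → 3 ≤ m → (i j : Fin m) → ∃ λ t → t ≢ i × t ≢ j
avoid-two (s≤s (s≤s (s≤s _))) zero          zero                = suc zero , (λ ()) , (λ ())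
avoid-two (s≤s (s≤s (s≤s _))) zero          (suc zero)          = suc (suc zero) , (λ ()) , (λ ())
avoid-two (s≤s (s≤s (s≤s _))) zero          (suc (suc _))       = suc zero , (λ ()) , (λ ())
avoid-two (s≤s (s≤s (s≤s _))) (suc zero)    zero                = suc (suc zero) , (λ ()) , (λ ())
avoid-two (s≤s (s≤s (s≤s _))) (suc (suc _)) zero                = suc zero , (λ ()) , (λ ())
avoid-two (s≤s (s≤s (s≤s _))) (suc _)       (suc _)             = zero , (λ ()) , (λ ())

Leaf : ∀ {k n} → Adj k n → Vertex k n → Set
Leaf G u = degree G u ≡ 1

isLeaf : ∀ {k n} → Adj k n → Vertex k n → Bool
isLeaf G u = degree G u ≡ᵇ 1

leavesIn : ∀ {k n} → Adj k n → Fin k → ℕ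
leavesIn G i = ∣ (λ u → inPart i u ∧ isLeaf G u) ∣

isLeaf⇒Leaf : ∀ {k n} {G : Adj k n} {u} → isLeaf G u ≡ true → Leaf G u
isLeaf⇒Leaf {G = G} {u} leaf = ≡ᵇ⇒≡ (degree G u) 1 (subst T (sym leaf) tt)

Leaf⇒isLeaf : ∀ {k n} {G : Adj k n} {u} → Leaf G u → isLeaf G u ≡ true
Leaf⇒isLeaf leaf rewrite leaf = refl

fullest-part : ∀ {k n} (G : Adj k n) {v₀} → Leaf G v₀ →
               ∃ λ P → (∀ i → leavesIn G i ≤ leavesIn G P) × ∃ λ v → Leaf G v × proj₁ v ≡ P
fullest-part {k} {n} G {v₀} v₀-leaf =
  P , P-fullest , v , isLeaf⇒Leaf {G = G} v-leaf , does-true (proj₁ v Fin.≟ P) v∈P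
  where
  P = argmax (leavesIn G) (proj₁ v₀) (allFin k)
  P-fullest : ∀ i → leavesIn G i ≤ leavesIn G P
  P-fullest i = All.lookup (f[xs]≤f[argmax] {f = leavesIn G} (proj₁ v₀) (allFin k)) (∈-allFin i)
  v₀-counted : 1 ≤ leavesIn G (proj₁ v₀)
  v₀-counted = ∈⇒1≤∑b2n (λ u → inPart (proj₁ v₀) u ∧ isLeaf G u) (∈-allVertices v₀)
                 (cong₂ _∧_ (dec-true (proj₁ v₀ Fin.≟ proj₁ v₀) refl) (Leaf⇒isLeaf {G = G} v₀-leaf))
  1≤leavesIn-P : 1 ≤ leavesIn G P
  1≤leavesIn-P = ≤-trans v₀-counted (f[⊥]≤f[argmax] {f = leavesIn G} (proj₁ v₀) (allFin k))
  v-found = 1≤∑b2n⇒∃ (allVertices k n) (λ u → inPart P u ∧ isLeaf G u) 1≤leavesIn-P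
  v = proj₁ v-found
  v∈P = proj₁ (∧-true {inPart P v} (proj₂ v-found))
  v-leaf = proj₂ (∧-true {inPart P v} (proj₂ v-found))

module Saturated {k n} {G : Adj k n} (sat : IsC4Saturated G) where
  open IsC4Saturated sat
  open IsSpanningSubgraph spanning

  infix 4 _~_
  _~_ : Vertex k n → Vertex k n → Set
  u ~ v = G u v ≡ true

  ~-sym : ∀ {u v} → u ~ v → v ~ u
  ~-sym {u} {v} u~v = trans (symmetric v u) u~v

  ~⇒part≢ : ∀ {u v} → u ~ v → proj₁ u ≢ proj₁ v
  ~⇒part≢ = inHost _ _

  ~⇒≢ : ∀ {u v} → u ~ v → u ≢ v
  ~⇒≢ u~v refl = ~⇒part≢ u~v refl

  no-C4 : ∀ {a b c d} → a ~ b → b ~ c → c ~ d → d ~ a → a ≢ c → b ≢ d → ⊥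
  no-C4 ab bc cd da a≢c b≢d =
    c4free (_ , _ , _ , _ , ~⇒≢ ab , a≢c , ~⇒≢ (~-sym da) , ~⇒≢ bc , b≢d , ~⇒≢ cd , ab , bc , cd , da)

  column-sum≡degree : ∀ w → ∑V (λ u → b2n (G u w)) ≡ degree G w
  column-sum≡degree w = ∑-cong (allVertices k n) (λ u → cong b2n (symmetric u w))

  degreeSum-even : 2 ∣ ∑V (degree G)
  degreeSum-even = ∑∑-even (allVertices k n) (λ u x → b2n (G u x)) (λ u x → cong b2n (symmetric u x)) no-loop
    where
    no-loop : ∀ u → b2n (G u u) ≡ 0
    no-loop u with G u u in u~u
    ... | true  = ⊥-elim (~⇒≢ u~u refl)
    ... | false = refl

  record Path₃ (u y : Vertex k n) : Set where
    constructor path₃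
    field
      {p q} : Vertex k n
      u~p   : u ~ p
      p~q   : p ~ q
      q~y   : q ~ y
      q≢u   : q ≢ u

  JoinsPair : (u y a b : Vertex k n) → Set
  JoinsPair u y a b = (a ≡ u × b ≡ y) ⊎ (a ≡ y × b ≡ u)

  addEdge-cases : ∀ {u y a b} → addEdge G u y a b ≡ true → a ~ b ⊎ JoinsPair u y a b
  addEdge-cases {u} {y} {a} {b} e with G a b in a~b
  ... | true  = inj₁ refl
  ... | false with ∨-true {does (a ≟V u) ∧ does (b ≟V y)} e
  ...   | inj₁ ab=uy = let a=u , b=y = ∧-true {does (a ≟V u)} ab=uy in
                       inj₂ (inj₁ (does-true (a ≟V u) a=u , does-true (b ≟V y) b=y))
  ...   | inj₂ ab=yu = let a=y , b=u = ∧-true {does (a ≟V y)} ab=yu in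
                       inj₂ (inj₂ (does-true (a ≟V y) a=y , does-true (b ≟V u) b=u))

  addEdge-oldˡ : ∀ {u y a b} → addEdge G u y a b ≡ true → a ≢ u → a ≢ y → a ~ b
  addEdge-oldˡ e a≢u a≢y with addEdge-cases e
  ... | inj₁ a~b                = a~b
  ... | inj₂ (inj₁ (a=u , _))   = ⊥-elim (a≢u a=u)
  ... | inj₂ (inj₂ (a=y , _))   = ⊥-elim (a≢y a=y)

  addEdge-oldʳ : ∀ {u y a b} → addEdge G u y a b ≡ true → b ≢ u → b ≢ y → a ~ b
  addEdge-oldʳ e b≢u b≢y with addEdge-cases e
  ... | inj₁ a~b                = a~b
  ... | inj₂ (inj₁ (_ , b=y))   = ⊥-elim (b≢y b=y)
  ... | inj₂ (inj₂ (_ , b=u))   = ⊥-elim (b≢u b=u)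

  rotate : ∀ {H : Adj k n} → ContainsC4 H → ContainsC4 H
  rotate (a , b , c , d , a≢b , a≢c , a≢d , b≢c , b≢d , c≢d , ab , bc , cd , da) =
    b , c , d , a , b≢c , b≢d , ≢-sym a≢b , c≢d , ≢-sym a≢c , ≢-sym a≢d , bc , cd , da , ab

  FirstEdgeJoins : ∀ u y → ContainsC4 (addEdge G u y) → Set
  FirstEdgeJoins u y (a , b , _) = JoinsPair u y a b

  Path₃-from-C4 : ∀ {u y} (C : ContainsC4 (addEdge G u y)) → FirstEdgeJoins u y C → Path₃ u y
  Path₃-from-C4 (a , b , c , d , a≢b , a≢c , a≢d , b≢c , b≢d , c≢d , _ , bc , cd , da) (inj₁ (refl , refl)) =
    path₃ (~-sym (addEdge-oldˡ da (≢-sym a≢d) (≢-sym b≢d)))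
          (~-sym (addEdge-oldˡ cd (≢-sym a≢c) (≢-sym b≢c)))
          (~-sym (addEdge-oldʳ bc (≢-sym a≢c) (≢-sym b≢c)))
          (≢-sym a≢c)
  Path₃-from-C4 (a , b , c , d , a≢b , a≢c , a≢d , b≢c , b≢d , c≢d , _ , bc , cd , da) (inj₂ (refl , refl)) =
    path₃ (addEdge-oldʳ bc (≢-sym b≢c) (≢-sym a≢c))
          (addEdge-oldˡ cd (≢-sym b≢c) (≢-sym a≢c))
          (addEdge-oldˡ da (≢-sym b≢d) (≢-sym a≢d))
          (≢-sym b≢d)

  nonadjacent⇒Path₃ : ∀ {u y} → HostEdge u y → ¬ (u ~ y) → Path₃ u y
  nonadjacent⇒Path₃ {u} {y} host u≁y = via-new-edge (saturated u y host (¬-not u≁y))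
    where
    via-new-edge : ContainsC4 (addEdge G u y) → Path₃ u y
    via-new-edge C@(_ , _ , _ , _ , _ , a≢c , _ , _ , b≢d , _ , ab , bc , cd , da)
      with addEdge-cases ab | addEdge-cases bc | addEdge-cases cd | addEdge-cases da
    ... | inj₂ new | _        | _        | _        = Path₃-from-C4 C new
    ... | inj₁ _   | inj₂ new | _        | _        = Path₃-from-C4 (rotate C) new
    ... | inj₁ _   | inj₁ _   | inj₂ new | _        = Path₃-from-C4 (rotate (rotate C)) new
    ... | inj₁ _   | inj₁ _   | inj₁ _   | inj₂ new = Path₃-from-C4 (rotate (rotate (rotate C))) new
    ... | inj₁ ab′ | inj₁ bc′ | inj₁ cd′ | inj₁ da′ = ⊥-elim (no-C4 ab′ bc′ cd′ da′ a≢c b≢d)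

  ∃-neighbour : ∀ {u} → 1 ≤ degree G u → ∃ (u ~_)
  ∃-neighbour {u} = 1≤∑b2n⇒∃ (allVertices k n) (G u)

  2≤degree : ∀ {u a b} → a ≢ b → u ~ a → u ~ b → 2 ≤ degree G u
  2≤degree {u} {a} {b} a≢b u~a u~b = begin
    2                                                      ≡⟨ cong₂ _+_ (∣≟V∣ a) (∣≟V∣ b) ⟨
    ∣ (λ x → does (x ≟V a)) ∣ + ∣ (λ x → does (x ≟V b)) ∣  ≡⟨ ∑-+ (allVertices k n) _ _ ⟨
    ∑V (λ x → b2n (does (x ≟V a)) + b2n (does (x ≟V b)))  ≤⟨ ∑-mono-≤ (allVertices k n) a-or-b ⟩
    degree G u                                             ∎
    where
    open ≤-Reasoning
    a-or-b : ∀ x → b2n (does (x ≟V a)) + b2n (does (x ≟V b)) ≤ b2n (G u x)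
    a-or-b x = decide (x ≟V a) (x ≟V b)
      where
      decide : (x=a? : Dec (x ≡ a)) (x=b? : Dec (x ≡ b)) → b2n (does x=a?) + b2n (does x=b?) ≤ b2n (G u x)
      decide (yes refl) (yes refl) = ⊥-elim (a≢b refl)
      decide (yes refl) (no _)     rewrite u~a = ≤-refl
      decide (no _)     (yes refl) rewrite u~b = ≤-refl
      decide (no _)     (no _)     = z≤n

  leaf-neighbour-unique : ∀ {u a b} → Leaf G u → u ~ a → u ~ b → a ≡ b
  leaf-neighbour-unique {a = a} {b} u-leaf u~a u~b with a ≟V b
  ... | yes a=b = a=b
  ... | no  a≢b with s≤s () ← subst (2 ≤_) u-leaf (2≤degree a≢b u~a u~b)

  leaf-≁-other-part : ∀ {l c y} → Leaf G l → l ~ c → proj₁ y ≢ proj₁ c → ¬ (l ~ y)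
  leaf-≁-other-part l-leaf l~c y≢c l~y = y≢c (cong proj₁ (leaf-neighbour-unique l-leaf l~y l~c))

  leaves-nonadjacent : 3 ≤ k → ∀ {l l′} → Leaf G l → Leaf G l′ → ¬ (l ~ l′)
  leaves-nonadjacent 3≤k {l} {l′} l-leaf l′-leaf l~l′
    with t , t≢l , t≢l′ ← avoid-two 3≤k (proj₁ l) (proj₁ l′)
    with path₃ l~p p~q _ q≢l ← nonadjacent⇒Path₃ {y = t , proj₂ l} (t≢l ∘ sym)
                                  (leaf-≁-other-part l-leaf l~l′ t≢l′)
    with refl ← leaf-neighbour-unique l-leaf l~p l~l′
    = q≢l (leaf-neighbour-unique l′-leaf p~q (~-sym l~l′))

  leaf-neighbours-adjacent : 3 ≤ k → ∀ {l l′ c c′} → Leaf G l → Leaf G l′ → proj₁ l ≢ proj₁ l′ →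
                             l ~ c → l′ ~ c′ → c ~ c′
  leaf-neighbours-adjacent 3≤k l-leaf l′-leaf l≢l′ l~c l′~c′
    with path₃ l~p p~q q~l′ _ ← nonadjacent⇒Path₃ l≢l′ (leaves-nonadjacent 3≤k l-leaf l′-leaf)
    with refl ← leaf-neighbour-unique l-leaf l~p l~c
    with refl ← leaf-neighbour-unique l′-leaf (~-sym q~l′) l′~c′
    = p~q

-- For a vertex u: p = [u ∈ P], iw = [u = w], nw = [u ∈ N(w)], l = [u is a leaf]; the right-hand
-- side reads 2[u ∈ N(w)] + ([u ∈ X] + [u ∈ E] + [u ∈ B]) + 3[u = w] + [u is a leaf outside P].
vertex-weight : ∀ p iw nw l → (iw ≡ true → p ≡ false) → (iw ≡ true → nw ≡ false) →
  3 * b2n (not p) + (b2n p + b2n (p ∧ nw))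
  ≤ 2 * b2n nw
    + (b2n (not p ∧ not iw) + b2n (not nw ∧ (p ∨ not iw ∧ not l)) + b2n ((not p ∧ not iw) ∧ not nw))
    + (3 * b2n iw + b2n (not p ∧ l))
vertex-weight true  true  _     _     iw⇒¬p _      with () ← iw⇒¬p refl
vertex-weight false true  true  _     _     iw⇒¬nw with () ← iw⇒¬nw refl
vertex-weight false true  false true  _ _ = ≤ᵇ⇒≤ _ _ _
vertex-weight false true  false false _ _ = ≤ᵇ⇒≤ _ _ _
vertex-weight true  false true  _     _ _ = ≤ᵇ⇒≤ _ _ _
vertex-weight true  false false _     _ _ = ≤ᵇ⇒≤ _ _ _
vertex-weight false false true  true  _ _ = ≤ᵇ⇒≤ _ _ _
vertex-weight false false true  false _ _ = ≤ᵇ⇒≤ _ _ _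
vertex-weight false false false true  _ _ = ≤ᵇ⇒≤ _ _ _
vertex-weight false false false false _ _ = ≤ᵇ⇒≤ _ _ _

module Counting {k n} {G : Adj k n} (sat : IsC4Saturated G) (3≤k : 3 ≤ k)
                (δ≥1 : ∀ u → 1 ≤ degree G u)
                {P : Fin k} (P-fullest : ∀ i → leavesIn G i ≤ leavesIn G P)
                {v w : Vertex k n} (v-leaf : Leaf G v) (v∈P : proj₁ v ≡ P) (v~w : G v w ≡ true) where
  open Saturated sat

  inP isW adjW X B E leafOutside P∩N[w] : Vertex k n → Bool
  inP           = inPart P
  isW u         = does (u ≟V w)
  adjW          = G w
  X u           = not (inP u) ∧ not (isW u)
  B u           = X u ∧ not (adjW u)
  E u           = not (adjW u) ∧ (inP u ∨ not (isW u) ∧ not (isLeaf G u))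
  leafOutside u = not (inP u) ∧ isLeaf G u
  P∩N[w] u      = inP u ∧ adjW u

  w∉P : proj₁ w ≢ P
  w∉P w∈P = ~⇒part≢ v~w (trans v∈P (sym w∈P))

  w≁w : ¬ (w ~ w)
  w≁w w~w = ~⇒≢ w~w refl

  X⇒ : ∀ {u} → X u ≡ true → proj₁ u ≢ P × u ≢ w
  X⇒ {u} Xu = let u∉P , u≠w = ∧-true {not (inP u)} Xu in
              does-false (proj₁ u Fin.≟ P) (not-true u∉P) , does-false (u ≟V w) (not-true u≠w)

  X⇒~N[w] : ∀ {u} → X u ≡ true → ∃ λ a → w ~ a × u ~ a
  X⇒~N[w] {u} Xu
    with u∉P , u≢w ← X⇒ Xu
    with path₃ v~p p~q q~u _ ← nonadjacent⇒Path₃ (λ v=u → u∉P (trans (sym v=u) v∈P))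
                                  (λ v~u → u≢w (leaf-neighbour-unique v-leaf v~u v~w))
    with refl ← leaf-neighbour-unique v-leaf v~p v~w
    = _ , p~q , ~-sym q~u

  X-w : X w ≢ true
  X-w Xw = proj₂ (X⇒ Xw) refl

  E⇒ : ∀ {u} → E u ≡ true → ¬ (w ~ u) × (proj₁ u ≡ P ⊎ (u ≢ w × ¬ Leaf G u))
  E⇒ {u} Eu with ¬adj , rest ← ∧-true {not (adjW u)} Eu with ∨-true {inP u} rest
  ... | inj₁ u∈P = not-¬ (not-true ¬adj) , inj₁ (does-true (proj₁ u Fin.≟ P) u∈P)
  ... | inj₂ u≠w∧¬leaf with u≠w , ¬leaf ← ∧-true {not (isW u)} u≠w∧¬leaf =
    not-¬ (not-true ¬adj) ,
    inj₂ (does-false (u ≟V w) (not-true u≠w) , not-¬ (not-true ¬leaf) ∘ Leaf⇒isLeaf {G = G})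

  E-w : E w ≢ true
  E-w Ew with E⇒ Ew
  ... | _ , inj₁ w∈P       = w∉P w∈P
  ... | _ , inj₂ (w≢w , _) = w≢w refl

  E∧X⇒non-leaf : ∀ {u} → E u ≡ true → X u ≡ true → ¬ Leaf G u
  E∧X⇒non-leaf {u} Eu Xu with proj₂ (E⇒ {u} Eu)
  ... | inj₁ u∈P          = ⊥-elim (proj₁ (X⇒ {u} Xu) u∈P)
  ... | inj₂ (_ , ¬leaf)  = ¬leaf

  B⇒ : ∀ {x} → B x ≡ true → X x ≡ true × ¬ (w ~ x)
  B⇒ {x} Bx with Xx , ¬adj ← ∧-true {X x} Bx = Xx , not-¬ (not-true ¬adj)

  atW toW viaX intoB : Vertex k n → Vertex k n → Bool
  atW   u x = isW u ∧ G u x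
  toW   u x = isW x ∧ G u x
  viaX  u x = (E u ∨ X u ∧ adjW x) ∧ G u x
  intoB u x = (B x ∧ adjW u) ∧ G u x

  intoB-row : Vertex k n → ℕ
  intoB-row u = ∑V (λ x → b2n (intoB u x))

  edge-classes : List (Vertex k n → Vertex k n → Bool)
  edge-classes = atW ∷ toW ∷ viaX ∷ intoB ∷ []

  edge-classes-disjoint : ∀ u x → ∑ edge-classes (λ c → b2n (c u x)) ≤ b2n (G u x)
  edge-classes-disjoint u x =
    sum-b2n-disjoint {bs = atW u x ∷ toW u x ∷ viaX u x ∷ intoB u x ∷ []}
      (edge {isW u} ∷ edge {isW x} ∷ edge {E u ∨ X u ∧ adjW x} ∷ edge {B x ∧ adjW u} ∷ [])
      ((atW#toW ∷ atW#viaX ∷ atW#intoB ∷ []) ∷ (toW#viaX ∷ toW#intoB ∷ []) ∷ (viaX#intoB ∷ []) ∷ [] ∷ [])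
    where
    edge : ∀ {c} → c ∧ G u x ≡ true → u ~ x
    edge {c} e = proj₂ (∧-true {c} e)
    u=w : atW u x ≡ true → u ≡ w
    u=w e = does-true (u ≟V w) (proj₁ (∧-true {isW u} e))
    x=w : toW u x ≡ true → x ≡ w
    x=w e = does-true (x ≟V w) (proj₁ (∧-true {isW x} e))
    via : viaX u x ≡ true → E u ≡ true ⊎ (X u ≡ true × w ~ x)
    via e with ∨-true {E u} (proj₁ (∧-true {E u ∨ X u ∧ adjW x} e))
    ... | inj₁ Eu  = inj₁ Eu
    ... | inj₂ X∧w = inj₂ (∧-true {X u} X∧w)
    into : intoB u x ≡ true → B x ≡ true × w ~ u
    into e = ∧-true {B x} (proj₁ (∧-true {B x ∧ adjW u} e))

    atW#toW : atW u x ≡ true → toW u x ≡ true → ⊥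
    atW#toW a t with refl ← u=w a | refl ← x=w t = w≁w (edge {isW w} a)
    atW#viaX : atW u x ≡ true → viaX u x ≡ true → ⊥
    atW#viaX a e with refl ← u=w a with via e
    ... | inj₁ Ew       = E-w Ew
    ... | inj₂ (Xw , _) = X-w Xw
    atW#intoB : atW u x ≡ true → intoB u x ≡ true → ⊥
    atW#intoB a i with refl ← u=w a = w≁w (proj₂ (into i))
    toW#viaX : toW u x ≡ true → viaX u x ≡ true → ⊥
    toW#viaX t e with refl ← x=w t with via e
    ... | inj₁ Eu        = proj₁ (E⇒ Eu) (~-sym (edge {isW w} t))
    ... | inj₂ (_ , w~w) = w≁w w~w
    toW#intoB : toW u x ≡ true → intoB u x ≡ true → ⊥
    toW#intoB t i with refl ← x=w t = X-w (proj₁ (B⇒ (proj₁ (into i))))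
    viaX#intoB : viaX u x ≡ true → intoB u x ≡ true → ⊥
    viaX#intoB e i with Bx , w~u ← into i with via e
    ... | inj₁ Eu        = proj₁ (E⇒ Eu) w~u
    ... | inj₂ (_ , w~x) = proj₂ (B⇒ Bx) w~x

  atW-row : ∀ u → ∑V (λ x → b2n (atW u x)) ≡ b2n (isW u) * degree G u
  atW-row u = trans (∑-cong (allVertices k n) (λ x → b2n-∧ (isW u) (G u x)))
                    (∑-*ˡ (allVertices k n) (b2n (isW u)) (λ x → b2n (G u x)))

  toW-row : ∀ u → ∑V (λ x → b2n (toW u x)) ≡ b2n (G u w)
  toW-row u = trans (∑-cong (allVertices k n) (λ x → b2n-∧ (isW x) (G u x)))
                    (∑V-select (λ x → b2n (G u x)) w)

  -- For u ∈ E every edge at u is counted, and if moreover u ∈ X then u is not a leaf.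
  viaX-row : ∀ u → b2n (X u) + b2n (E u) ≤ ∑V (λ x → b2n (viaX u x))
  viaX-row u with E u in Eu | X u in Xu
  ... | true  | false = δ≥1 u
  ... | true  | true  = ≤∧≢⇒< (δ≥1 u) (E∧X⇒non-leaf Eu Xu ∘ sym)
  ... | false | false = z≤n
  ... | false | true  with a , w~a , u~a ← X⇒~N[w] Xu =
    ∈⇒1≤∑b2n (λ x → adjW x ∧ G u x) (∈-allVertices a) (cong₂ _∧_ w~a u~a)

  intoB-column : ∀ x → b2n (B x) ≤ ∑V (λ u → b2n (intoB u x))
  intoB-column x with B x in Bx
  ... | false = z≤n
  ... | true  with a , w~a , x~a ← X⇒~N[w] (proj₁ (B⇒ Bx)) =
    ∈⇒1≤∑b2n (λ u → adjW u ∧ G u x) (∈-allVertices a) (cong₂ _∧_ w~a (~-sym x~a))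

  row-bound : ∀ u → b2n (isW u) * degree G u + (b2n (G u w) + (b2n (X u) + b2n (E u) + intoB-row u))
                    ≤ degree G u
  row-bound u = begin
    b2n (isW u) * degree G u + (b2n (G u w) + (b2n (X u) + b2n (E u) + intoB-row u))
      ≤⟨ +-mono-≤ (≤-reflexive (sym (atW-row u)))
                  (+-mono-≤ (≤-reflexive (sym (toW-row u))) (+-monoˡ-≤ _ (viaX-row u))) ⟩
    row atW + (row toW + (row viaX + row intoB))
      ≡⟨ cong (λ t → row atW + (row toW + (row viaX + t))) (+-identityʳ (row intoB)) ⟨
    ∑ edge-classes row
      ≡⟨ ∑-comm (allVertices k n) edge-classes (λ x c → b2n (c u x)) ⟨
    ∑V (λ x → ∑ edge-classes (λ c → b2n (c u x)))
      ≤⟨ ∑-mono-≤ (allVertices k n) (edge-classes-disjoint u) ⟩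
    degree G u ∎
    where
    open ≤-Reasoning
    row : (Vertex k n → Vertex k n → Bool) → ℕ
    row c = ∑V (λ x → b2n (c u x))

  degreeSum-lower : 2 * degree G w + (∣ X ∣ + ∣ E ∣ + ∣ B ∣) ≤ ∑V (degree G)
  degreeSum-lower = begin
    2 * dw + (∣ X ∣ + ∣ E ∣ + ∣ B ∣)
      ≡⟨ trans (+-assoc dw (dw + 0) (∣ X ∣ + ∣ E ∣ + ∣ B ∣))
               (cong (λ t → dw + (t + (∣ X ∣ + ∣ E ∣ + ∣ B ∣))) (+-identityʳ dw)) ⟩
    dw + (dw + (∣ X ∣ + ∣ E ∣ + ∣ B ∣))
      ≤⟨ +-monoʳ-≤ dw (+-monoʳ-≤ dw (+-monoʳ-≤ (∣ X ∣ + ∣ E ∣) ∣B∣≤intoB)) ⟩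
    dw + (dw + (∣ X ∣ + ∣ E ∣ + ∑V intoB-row))
      ≡⟨ sum-rows ⟨
    ∑V (λ u → b2n (isW u) * degree G u + (b2n (G u w) + (b2n (X u) + b2n (E u) + intoB-row u)))
      ≤⟨ ∑-mono-≤ (allVertices k n) row-bound ⟩
    ∑V (degree G) ∎
    where
    open ≤-Reasoning
    dw = degree G w
    Vs = allVertices k n
    ∣B∣≤intoB : ∣ B ∣ ≤ ∑V intoB-row
    ∣B∣≤intoB = ≤-trans (∑-mono-≤ Vs intoB-column) (≤-reflexive (∑-comm Vs Vs (λ x u → b2n (intoB u x))))
    sum-rows : ∑V (λ u → b2n (isW u) * degree G u + (b2n (G u w) + (b2n (X u) + b2n (E u) + intoB-row u)))
               ≡ dw + (dw + (∣ X ∣ + ∣ E ∣ + ∑V intoB-row))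
    sum-rows =
      trans (∑-+ Vs _ _) (cong₂ _+_ (∑V-select (degree G) w)
      (trans (∑-+ Vs _ _) (cong₂ _+_ (column-sum≡degree w)
      (trans (∑-+ Vs _ _) (cong (_+ ∑V intoB-row) (∑-+ Vs _ _))))))

  weighted-count : 3 * ((k ∸ 1) * n) + (n + ∣ P∩N[w] ∣)
                   ≤ 2 * degree G w + (∣ X ∣ + ∣ E ∣ + ∣ B ∣) + (3 + ∣ leafOutside ∣)
  weighted-count = begin
    3 * ((k ∸ 1) * n) + (n + ∣ P∩N[w] ∣)
      ≡⟨ cong₂ (λ a b → 3 * a + (b + ∣ P∩N[w] ∣)) (∣outsidePart∣ P) (∣inPart∣ P) ⟨
    3 * ∣ (λ u → not (inP u)) ∣ + (∣ inP ∣ + ∣ P∩N[w] ∣)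
      ≡⟨ sum-lhs ⟨
    ∑V (λ u → 3 * b2n (not (inP u)) + (b2n (inP u) + b2n (P∩N[w] u)))
      ≤⟨ ∑-mono-≤ Vs (λ u → vertex-weight (inP u) (isW u) (adjW u) (isLeaf G u) (w⇒∉P u) (w⇒≁w u)) ⟩
    ∑V (λ u → 2 * b2n (adjW u) + (b2n (X u) + b2n (E u) + b2n (B u))
              + (3 * b2n (isW u) + b2n (leafOutside u)))
      ≡⟨ sum-rhs ⟩
    2 * degree G w + (∣ X ∣ + ∣ E ∣ + ∣ B ∣) + (3 + ∣ leafOutside ∣) ∎
    where
    open ≤-Reasoning
    Vs = allVertices k n
    w⇒∉P : ∀ u → isW u ≡ true → inP u ≡ false
    w⇒∉P u u=w rewrite does-true (u ≟V w) u=w = dec-false (proj₁ w Fin.≟ P) w∉P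
    w⇒≁w : ∀ u → isW u ≡ true → adjW u ≡ false
    w⇒≁w u u=w rewrite does-true (u ≟V w) u=w = ¬-not w≁w
    sum-lhs : ∑V (λ u → 3 * b2n (not (inP u)) + (b2n (inP u) + b2n (P∩N[w] u)))
              ≡ 3 * ∣ (λ u → not (inP u)) ∣ + (∣ inP ∣ + ∣ P∩N[w] ∣)
    sum-lhs = trans (∑-+ Vs _ _) (cong₂ _+_ (∑-*ˡ Vs 3 _) (∑-+ Vs _ _))
    sum-rhs : ∑V (λ u → 2 * b2n (adjW u) + (b2n (X u) + b2n (E u) + b2n (B u))
                        + (3 * b2n (isW u) + b2n (leafOutside u)))
              ≡ 2 * degree G w + (∣ X ∣ + ∣ E ∣ + ∣ B ∣) + (3 + ∣ leafOutside ∣)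
    sum-rhs =
      trans (∑-+ Vs _ _)
        (cong₂ _+_
          (trans (∑-+ Vs _ _) (cong₂ _+_ (∑-*ˡ Vs 2 _) (trans (∑-+ Vs _ _) (cong (_+ ∣ B ∣) (∑-+ Vs _ _)))))
          (trans (∑-+ Vs _ _) (cong (_+ ∣ leafOutside ∣) (trans (∑-*ˡ Vs 3 _) (cong (3 *_) (∣≟V∣ w))))))

  leafOutside⇒ : ∀ {u} → leafOutside u ≡ true → proj₁ u ≢ P × Leaf G u
  leafOutside⇒ {u} lo = let u∉P , u-leaf = ∧-true {not (inP u)} lo in
    does-false (proj₁ u Fin.≟ P) (not-true u∉P) , isLeaf⇒Leaf {G = G} u-leaf

  module TwoOuterLeaves {b b′} (b-leaf : Leaf G b) (b∉P : proj₁ b ≢ P)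
                        (b′-leaf : Leaf G b′) (b′∉P : proj₁ b′ ≢ P) (b≢b′ : proj₁ b ≢ proj₁ b′) where
    c c′ : Vertex k n
    c  = proj₁ (∃-neighbour (δ≥1 b))
    c′ = proj₁ (∃-neighbour (δ≥1 b′))
    b~c : b ~ c
    b~c = proj₂ (∃-neighbour (δ≥1 b))
    b′~c′ : b′ ~ c′
    b′~c′ = proj₂ (∃-neighbour (δ≥1 b′))

    w~c : w ~ c
    w~c = leaf-neighbours-adjacent 3≤k v-leaf b-leaf (λ v=b → b∉P (trans (sym v=b) v∈P)) v~w b~c
    w~c′ : w ~ c′
    w~c′ = leaf-neighbours-adjacent 3≤k v-leaf b′-leaf (λ v=b′ → b′∉P (trans (sym v=b′) v∈P)) v~w b′~c′
    c~c′ : c ~ c′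
    c~c′ = leaf-neighbours-adjacent 3≤k b-leaf b′-leaf b≢b′ b~c b′~c′

    leaf∈P⇒~w : ∀ {u} → Leaf G u → proj₁ u ≡ P → w ~ u
    leaf∈P⇒~w {u} u-leaf u∈P with d , u~d ← ∃-neighbour (δ≥1 u) with d ≟V w
    ... | yes refl = ~-sym u~d
    ... | no  d≢w  = ⊥-elim (no-C4 w~c (~-sym d~c) d~c′ (~-sym w~c′) (d≢w ∘ sym) (~⇒≢ c~c′))
      where
      d~c : d ~ c
      d~c = leaf-neighbours-adjacent 3≤k u-leaf b-leaf (λ u=b → b∉P (trans (sym u=b) u∈P)) u~d b~c
      d~c′ : d ~ c′
      d~c′ = leaf-neighbours-adjacent 3≤k u-leaf b′-leaf (λ u=b′ → b′∉P (trans (sym u=b′) u∈P)) u~d b′~c′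

    leaf∈P∪b∪b′ : ∀ {u} → Leaf G u → proj₁ u ≢ P → proj₁ u ≢ proj₁ b → proj₁ u ≢ proj₁ b′ → ⊥
    leaf∈P∪b∪b′ {u} u-leaf u∉P u≢b u≢b′ with d , u~d ← ∃-neighbour (δ≥1 u) =
      no-C4 w~c c~c′ (~-sym d~c′) d~w (~⇒≢ w~c′) (~⇒≢ (~-sym d~c))
      where
      d~c : d ~ c
      d~c = leaf-neighbours-adjacent 3≤k u-leaf b-leaf u≢b u~d b~c
      d~c′ : d ~ c′
      d~c′ = leaf-neighbours-adjacent 3≤k u-leaf b′-leaf u≢b′ u~d b′~c′
      d~w : d ~ w
      d~w = leaf-neighbours-adjacent 3≤k u-leaf v-leaf (λ u=v → u∉P (trans u=v v∈P)) u~d v~w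

    leaves-outside≤-two-parts : ∣ leafOutside ∣ ≤ n + ∣ P∩N[w] ∣
    leaves-outside≤-two-parts = begin
      ∣ leafOutside ∣
        ≤⟨ ∑-mono-≤ Vs in-R-or-S ⟩
      ∑V (λ u → b2n (inPart R u ∧ isLeaf G u) + b2n (inPart S u ∧ isLeaf G u))
        ≡⟨ ∑-+ Vs _ _ ⟩
      leavesIn G R + leavesIn G S
        ≤⟨ +-mono-≤ (≤-trans (P-fullest R) leaves∈P≤) leaves∈S≤ ⟩
      ∣ P∩N[w] ∣ + n
        ≡⟨ +-comm _ n ⟩
      n + ∣ P∩N[w] ∣ ∎
      where
      open ≤-Reasoning
      Vs = allVertices k n
      R = proj₁ b
      S = proj₁ b′
      in-R-or-S : ∀ u → b2n (leafOutside u) ≤ b2n (inPart R u ∧ isLeaf G u) + b2n (inPart S u ∧ isLeaf G u)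
      in-R-or-S u with leafOutside u in lo
      ... | false = z≤n
      ... | true with u∉P , u-leaf ← leafOutside⇒ lo
                 rewrite Leaf⇒isLeaf {G = G} u-leaf
                 with inPart R u in u∈R | inPart S u in u∈S
      ... | true  | _     = s≤s z≤n
      ... | false | true  = ≤-refl
      ... | false | false = ⊥-elim (leaf∈P∪b∪b′ u-leaf u∉P (does-false (proj₁ u Fin.≟ R) u∈R)
                                                            (does-false (proj₁ u Fin.≟ S) u∈S))
      leaves∈P≤ : leavesIn G P ≤ ∣ P∩N[w] ∣
      leaves∈P≤ = ∑-mono-≤ Vs adjacent-to-w
        where
        adjacent-to-w : ∀ u → b2n (inP u ∧ isLeaf G u) ≤ b2n (P∩N[w] u)
        adjacent-to-w u with inP u in u∈P | isLeaf G u in u-leaf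
        ... | false | _     = z≤n
        ... | true  | false = z≤n
        ... | true  | true
          rewrite leaf∈P⇒~w (isLeaf⇒Leaf {G = G} u-leaf) (does-true (proj₁ u Fin.≟ P) u∈P) = ≤-refl
      leaves∈S≤ : leavesIn G S ≤ n
      leaves∈S≤ = ≤-trans (∑-mono-≤ Vs (λ u → b2n-∧-≤ˡ (inPart S u) (isLeaf G u))) (≤-reflexive (∣inPart∣ S))

  leaves-outside≤-one-part : ∀ R → (∀ u → leafOutside u ≡ true → inPart R u ≡ true) → ∣ leafOutside ∣ ≤ n
  leaves-outside≤-one-part R ⇒R = ≤-trans (∑-mono-≤ (allVertices k n) in-R) (≤-reflexive (∣inPart∣ R))
    where
    in-R : ∀ u → b2n (leafOutside u) ≤ b2n (inPart R u)
    in-R u with leafOutside u in lo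
    ... | false = z≤n
    ... | true rewrite ⇒R u lo = ≤-refl

  leaves-outside≤ : ∣ leafOutside ∣ ≤ n + ∣ P∩N[w] ∣
  leaves-outside≤ with 1 ≤? ∣ leafOutside ∣
  ... | no  none = ≤-trans (≤-reflexive (n<1⇒n≡0 (≰⇒> none))) z≤n
  ... | yes some with b , b-out ← 1≤∑b2n⇒∃ (allVertices k n) leafOutside some
                 with b∉P , b-leaf ← leafOutside⇒ b-out
                 with 1 ≤? ∣ (λ u → leafOutside u ∧ not (inPart (proj₁ b) u)) ∣
  ... | no  one-part = ≤-trans (leaves-outside≤-one-part (proj₁ b) in-part-of-b) (m≤m+n n _)
    where
    in-part-of-b : ∀ u → leafOutside u ≡ true → inPart (proj₁ b) u ≡ true
    in-part-of-b u lo with inPart (proj₁ b) u in u∈R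
    ... | true  = refl
    ... | false = ⊥-elim (one-part (∈⇒1≤∑b2n (λ u → leafOutside u ∧ not (inPart (proj₁ b) u))
                                               (∈-allVertices u) (cong₂ _∧_ lo (cong not u∈R))))
  ... | yes another
    with b′ , b′-out ← 1≤∑b2n⇒∃ (allVertices k n) (λ u → leafOutside u ∧ not (inPart (proj₁ b) u)) another
    with lo′ , b′∉R ← ∧-true {leafOutside b′} b′-out
    with b′∉P , b′-leaf ← leafOutside⇒ lo′
    = TwoOuterLeaves.leaves-outside≤-two-parts b-leaf b∉P b′-leaf b′∉P
        (≢-sym (does-false (proj₁ b′ Fin.≟ proj₁ b) (not-true b′∉R)))

  degreeSum-bound : 3 * ((k ∸ 1) * n) ≤ ∑V (degree G) + 3
  degreeSum-bound = +-cancelʳ-≤ Q _ _ (begin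
    3 * ((k ∸ 1) * n) + Q
      ≤⟨ weighted-count ⟩
    2 * degree G w + (∣ X ∣ + ∣ E ∣ + ∣ B ∣) + (3 + ∣ leafOutside ∣)
      ≤⟨ +-mono-≤ degreeSum-lower (+-monoʳ-≤ 3 leaves-outside≤) ⟩
    ∑V (degree G) + (3 + Q)
      ≡⟨ +-assoc (∑V (degree G)) 3 Q ⟨
    ∑V (degree G) + 3 + Q ∎)
    where
    open ≤-Reasoning
    Q = n + ∣ P∩N[w] ∣

proposition4p9 : (k n : ℕ) → 4 ≤ k → 1 ≤ n → (G : Adj k n) →
    IsC4Saturated G → MinDegree G 1 →
    (3 * (k ∸ 1) * n ∸ 2) / 2 ≤ edgeCount G
proposition4p9 k n 4≤k _ G sat (δ≥1 , v₀ , v₀-leaf)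
  with P , P-fullest , v , v-leaf , v∈P ← fullest-part G v₀-leaf
  with w , v~w ← Saturated.∃-neighbour sat (δ≥1 v)
  = subst (λ t → (t ∸ 2) / 2 ≤ edgeCount G) (sym (*-assoc 3 (k ∸ 1) n))
      (half-∸2-≤ (Saturated.degreeSum-even sat)
        (Counting.degreeSum-bound sat (<⇒≤ 4≤k) δ≥1 P-fullest v-leaf v∈P v~w))
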